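{- Let $G^{(0)}$ be a simple undirected graph on an $n$-vertex set $V$, let $\alpha\le\beta$ be real thresholds, let $C^{(t)}$ be the set of all unordered pairs of distinct vertices of $V$ for every $t$, and let the energy be $\mathcal{E}^{(t)}(u,v)=\min\{d_{G^{(t)}}(u),d_{G^{(t)}}(v)\}$. Then the process converges within $O(n)$ steps: there is an absolute constant $c$ such that for every such $G^{(0)}$, $\alpha$ and $\beta$ there exists $t\le cn$ with $G^{(t)}=G^{(t+1)}$. Moreover, this is tight: there exist an absolute constant $c'>0$ and, for infinitely many $n$, an $n$-vertex initial graph together with thresholds $\alpha\le\beta$ for which the convergence time is at least $c'n$.
   Context: Threshold network process: $V$ is a fixed finite vertex set, $G^{(t)}=(V,E^{(t)})$ is a simple undirected graph for $t=0,1,2,\dots$, and $d_{G}(u)$ denotes the degree of $u$ in $G$. Given thresholds $\alpha\le\beta$, interaction sets $C^{(t)}$ (sets of unordered pairs of distinct vertices) and energies $\mathcal{E}^{(t)}(u,v)$, the graph $G^{(t+1)}$ is obtained from $G^{(t)}$ as follows. For each pair $\{u,v\}\in C^{(t)}$: if $\mathcal{E}^{(t)}(u,v)<\alpha$ then $\{u,v\}\notin E^{(t+1)}$; if $\alpha\le \mathcal{E}^{(t)}(u,v)<\beta$ then $\{u,v\}\in E^{(t+1)}$ iff $\{u,v\}\in E^{(t)}$; if $\mathcal{E}^{(t)}(u,v)\ge\beta$ then $\{u,v\}\in E^{(t+1)}$. Pairs not in $C^{(t)}$ keep their status. The process converges if there is $t$ with $G^{(t)}=G^{(t+1)}$; the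 convergence time is the least such $t$. -}

module Defs where

open import Data.Bool using (Bool; true; false; if_then_else_)
open import Data.Nat using (ℕ; zero; suc; _⊓_)
open import Data.Fin using (Fin; _≟_)
open import Data.List using (List; map; allFin)
open import Data.Nat.ListAction using (sum)
open import Data.Product using (_×_)
open import Data.Integer using (ℤ; +_; _<?_)
open import Relation.Nullary using (does)
open import Relation.Binary.PropositionalEquality using (_≡_)

Graph : ℕ → Set
Graph n = Fin n → Fin n → Bool

SimpleGraph : ∀ {n} → Graph n → Set
SimpleGraph {n} G = (∀ (u v : Fin n) → G u v ≡ G v u) × (∀ (u : Fin n) → G u u ≡ false)

deg : ∀ {n} → Graph n → Fin n → ℕ
deg {n} G u = sum (map (λ v → if G u v then 1 else 0) (allFin n))

energy : ∀ {n} → Graph n → Fin n → Fin n → ℕ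
energy G u v = deg G u ⊓ deg G v

-- one step of the threshold process with thresholds α ≤ β, where the
-- interaction set C is all unordered pairs of distinct vertices.
-- Pairs {u,u} are not in C, so they keep their status.
step : ∀ {n} → ℤ → ℤ → Graph n → Graph n
step α β G u v =
  if does (u ≟ v) then G u v
  else (if does ((+ energy G u v) <? α) then false
        else (if does ((+ energy G u v) <? β) then G u v else true))

run : ∀ {n} → ℤ → ℤ → Graph n → ℕ → Graph n
run α β G zero = G
run α β G (suc t) = step α β (run α β G t)

StableAt : ∀ {n} → ℤ → ℤ → Graph n → ℕ → Set
StableAt {n} α β G t = ∀ (u v : Fin n) → run α β G t u v ≡ run α β G (suc t) u v

{-# OPTIONS --safe #-}
module Submission where

-- Once a vertex has degree below α, all its edges are deleted and it stays isolated,
-- so the set of such "low" vertices only grows and is constant after at most n steps.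
-- From then on every edge joins two vertices that are not low, so no edge is deleted any
-- more, degrees only grow, and the set of vertices of degree at least β only grows as well;
-- once it is constant (after at most n further steps), no new edge can appear.
-- For the lower bound take the path on n vertices with α = 2 and β = n + 1: nothing is
-- ever added, and each step deletes exactly the two end edges, so the path peels off
-- from both ends and needs about n / 2 steps to disappear.

open import Defs
open import Data.Nat using (ℕ; _≤_; _<_; _*_)
open import Data.Integer using (ℤ) renaming (_≤_ to _≤ℤ_)
open import Data.Product using (Σ; _×_)

open import Level using (Level; 0ℓ)
open import Data.Bool using (Bool; true; false; if_then_else_)
open import Data.Nat using (zero; suc; _+_; _⊓_; z≤n; s≤s)
import Data.Nat.Properties as ℕ
open import Data.Nat.ListAction using (sum)
open import Data.Nat.Tactic.RingSolver using (solve-∀)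
open import Data.Integer using (+_; +≤+; +<+; _<?_) renaming (_<_ to _<ℤ_; _≤?_ to _≤ℤ?_)
import Data.Integer.Properties as ℤ
open import Data.Fin using (Fin; toℕ; _≟_)
import Data.Fin as Fin
open import Data.Fin.Properties using (toℕ-fromℕ<; toℕ-injective)
open import Data.Fin.Subset using (Subset; _∈_; _∉_; _⊆_; _⊂_; ∣_∣; ⁅_⁆)
open import Data.Fin.Subset.Properties
  using (_∈?_; _⊂?_; nonempty?; Empty-unique; ∣⊥∣≡0; ∣⁅x⁆∣≡1; x∈⁅x⁆; x∈⁅y⁆⇒x≡y)
open import Data.Fin.Subset.Properties using (p⊆q⇒∣p∣≤∣q∣; p⊂q⇒∣p∣<∣q∣; ∣p∣≤n)
import Data.Vec as Vec
open import Data.Vec.Properties using (lookup∘tabulate; []=⇒lookup; lookup⇒[]=)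
import Data.List as List
open import Data.List.Properties using (map-tabulate; map-cong)
open import Data.Product using (∃-syntax; _,_; proj₁; proj₂)
open import Data.Sum using (_⊎_; inj₁; inj₂)
open import Function using (_∘_; _⇔_; mk⇔; Equivalence)
open import Function.Construct.Composition using (_⇔-∘_)
open import Relation.Nullary using (Dec; yes; no; does; ¬_)
open import Relation.Nullary.Negation using (contradiction)
open import Relation.Nullary.Decidable using (dec-false; does-⇔; _×-dec_; _⊎-dec_)
open import Relation.Unary using (Pred; Decidable) renaming (_⊆_ to _⊆ᵤ_)
open import Relation.Binary.PropositionalEquality
  using (_≡_; _≢_; refl; sym; trans; cong; cong₂; subst; subst₂; module ≡-Reasoning)

open Equivalence using (to; from)

private variable
  ℓ : Level
  n : ℕ

x∈tabulate⇔ : {f : Fin n → Bool} {x : Fin n} → x ∈ Vec.tabulate f ⇔ f x ≡ true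
x∈tabulate⇔ {f = f} {x} = mk⇔
  (λ x∈ → trans (sym (lookup∘tabulate f x)) ([]=⇒lookup x∈))
  (λ fx → lookup⇒[]= x (Vec.tabulate f) (trans (lookup∘tabulate f x) fx))

subsingleton⇒∣p∣≤1 : {p : Subset n} → (∀ {x y} → x ∈ p → y ∈ p → x ≡ y) → ∣ p ∣ ≤ 1
subsingleton⇒∣p∣≤1 {n = n} {p = p} unique with nonempty? p
... | no empty = subst (_≤ 1) (sym (trans (cong ∣_∣ (Empty-unique empty)) (∣⊥∣≡0 n))) z≤n
... | yes (x , x∈p) = subst (∣ p ∣ ≤_) (∣⁅x⁆∣≡1 x) (p⊆q⇒∣p∣≤∣q∣ p⊆⁅x⁆)
  where
  p⊆⁅x⁆ : p ⊆ ⁅ x ⁆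
  p⊆⁅x⁆ y∈p = subst (_∈ ⁅ x ⁆) (unique x∈p y∈p) (x∈⁅x⁆ x)

x∈p∧y∈p∧x≢y⇒2≤∣p∣ : {p : Subset n} {x y : Fin n} → x ∈ p → y ∈ p → x ≢ y → 2 ≤ ∣ p ∣
x∈p∧y∈p∧x≢y⇒2≤∣p∣ {p = p} {x} {y} x∈p y∈p x≢y =
  subst (_< ∣ p ∣) (∣⁅x⁆∣≡1 x) (p⊂q⇒∣p∣<∣q∣ ((λ {z} → ⁅x⁆⊆p {z}) , y , y∈p , y∉⁅x⁆))
  where
  ⁅x⁆⊆p : ⁅ x ⁆ ⊆ p
  ⁅x⁆⊆p z∈⁅x⁆ = subst (_∈ p) (sym (x∈⁅y⁆⇒x≡y x z∈⁅x⁆)) x∈p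
  y∉⁅x⁆ : y ∉ ⁅ x ⁆
  y∉⁅x⁆ y∈⁅x⁆ = x≢y (sym (x∈⁅y⁆⇒x≡y x y∈⁅x⁆))

⊆∧⊄⇒⊇ : {p q : Subset n} → p ⊆ q → ¬ p ⊂ q → q ⊆ p
⊆∧⊄⇒⊇ {p = p} p⊆q p⊄q {x} x∈q with x ∈? p
... | yes x∈p = x∈p
... | no x∉p = contradiction ((λ {y} → p⊆q {y}) , x , x∈q , x∉p) p⊄q

module _ (S : ℕ → Subset n) (S-mono : ∀ k → S k ⊆ S (suc k)) where

  private
    stabilises-or-grows : ∀ m → (∃[ k ] k < m × S (suc k) ⊆ S k) ⊎ m ≤ ∣ S m ∣
    stabilises-or-grows zero = inj₂ z≤n
    stabilises-or-grows (suc m) with stabilises-or-grows m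
    ... | inj₁ (k , k<m , stable) = inj₁ (k , ℕ.m<n⇒m<1+n k<m , stable)
    ... | inj₂ m≤∣Sm∣ with S m ⊂? S (suc m)
    ...   | yes Sm⊂ = inj₂ (ℕ.≤-<-trans m≤∣Sm∣ (p⊂q⇒∣p∣<∣q∣ Sm⊂))
    ...   | no Sm⊄ = inj₁ (m , ℕ.≤-refl , ⊆∧⊄⇒⊇ (S-mono m) Sm⊄)

  ⊆-chain-stabilises : ∃[ k ] k ≤ n × S (suc k) ⊆ S k
  ⊆-chain-stabilises with stabilises-or-grows (suc n)
  ... | inj₁ (k , k<1+n , stable) = k , ℕ.≤-pred k<1+n , stable
  ... | inj₂ 1+n≤∣S∣ = contradiction (∣p∣≤n (S (suc n))) (ℕ.<⇒≱ 1+n≤∣S∣)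

does≡true⇔ : {A : Set ℓ} (a? : Dec A) → does a? ≡ true ⇔ A
does≡true⇔ (yes a) = mk⇔ (λ _ → a) (λ _ → refl)
does≡true⇔ (no ¬a) = mk⇔ (λ ()) (λ a → contradiction a ¬a)

toSubset : {P : Pred (Fin n) ℓ} → Decidable P → Subset n
toSubset P? = Vec.tabulate (does ∘ P?)

x∈toSubset⇔ : {P : Pred (Fin n) ℓ} (P? : Decidable P) {x : Fin n} → x ∈ toSubset P? ⇔ P x
x∈toSubset⇔ P? {x} = does≡true⇔ (P? x) ⇔-∘ x∈tabulate⇔

module _ {P : ℕ → Pred (Fin n) ℓ} (P? : ∀ k → Decidable (P k)) (P-mono : ∀ k → P k ⊆ᵤ P (suc k)) where

  private
    toSubset-mono : ∀ k → toSubset (P? k) ⊆ toSubset (P? (suc k))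
    toSubset-mono k x∈ = from (x∈toSubset⇔ (P? (suc k))) (P-mono k (to (x∈toSubset⇔ (P? k)) x∈))

  decidable-chain-stabilises : ∃[ k ] k ≤ n × P (suc k) ⊆ᵤ P k
  decidable-chain-stabilises with ⊆-chain-stabilises (toSubset ∘ P?) toSubset-mono
  ... | k , k≤n , stable =
    k , k≤n , λ Px → to (x∈toSubset⇔ (P? k)) (stable (from (x∈toSubset⇔ (P? (suc k))) Px))

Bool-ext : {a b : Bool} → (a ≡ true → b ≡ true) → (b ≡ true → a ≡ true) → a ≡ b
Bool-ext {false} {false} _ _ = refl
Bool-ext {false} {true} _ b⇒a = b⇒a refl
Bool-ext {true} a⇒b _ = sym (a⇒b refl)

infix 4 _≋_
_≋_ : Graph n → Graph n → Set
G ≋ H = ∀ u v → G u v ≡ H u v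

neighbours : Graph n → Fin n → Subset n
neighbours G u = Vec.tabulate (G u)

private
  count-tabulate : (f : Fin n → Bool) →
                   sum (List.tabulate (λ v → if f v then 1 else 0)) ≡ ∣ Vec.tabulate f ∣
  count-tabulate {zero} f = refl
  count-tabulate {suc n} f with f Fin.zero
  ... | true = cong suc (count-tabulate (f ∘ Fin.suc))
  ... | false = count-tabulate (f ∘ Fin.suc)

deg≡∣neighbours∣ : (G : Graph n) (u : Fin n) → deg G u ≡ ∣ neighbours G u ∣
deg≡∣neighbours∣ G u =
  trans (cong sum (map-tabulate (λ v → v) (λ v → if G u v then 1 else 0))) (count-tabulate (G u))

v∈neighbours⇔ : (G : Graph n) (u : Fin n) {v : Fin n} → v ∈ neighbours G u ⇔ G u v ≡ true
v∈neighbours⇔ G u = x∈tabulate⇔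

module _ {G : Graph n} {u : Fin n} where

  deg≤n : deg G u ≤ n
  deg≤n = subst (_≤ n) (sym (deg≡∣neighbours∣ G u)) (∣p∣≤n (neighbours G u))

  deg≤1 : (∀ {v w} → G u v ≡ true → G u w ≡ true → v ≡ w) → deg G u ≤ 1
  deg≤1 unique = subst (_≤ 1) (sym (deg≡∣neighbours∣ G u))
    (subsingleton⇒∣p∣≤1 λ v∈ w∈ → unique (to (v∈neighbours⇔ G u) v∈) (to (v∈neighbours⇔ G u) w∈))

  2≤deg : ∀ {v w} → G u v ≡ true → G u w ≡ true → v ≢ w → 2 ≤ deg G u
  2≤deg uv uw v≢w = subst (2 ≤_) (sym (deg≡∣neighbours∣ G u))
    (x∈p∧y∈p∧x≢y⇒2≤∣p∣ (from (v∈neighbours⇔ G u) uv) (from (v∈neighbours⇔ G u) uw) v≢w)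

  module _ {H : Graph n} where

    deg-mono : (∀ {v} → G u v ≡ true → H u v ≡ true) → deg G u ≤ deg H u
    deg-mono G⊆H = subst₂ _≤_ (sym (deg≡∣neighbours∣ G u)) (sym (deg≡∣neighbours∣ H u))
      (p⊆q⇒∣p∣≤∣q∣ (from (v∈neighbours⇔ H u) ∘ G⊆H ∘ to (v∈neighbours⇔ G u)))

    deg-cong : G ≋ H → deg G u ≡ deg H u
    deg-cong G≋H = cong sum (map-cong (λ v → cong (λ b → if b then 1 else 0) (G≋H u v)) (List.allFin n))

energy-cong : {G H : Graph n} → G ≋ H → ∀ u v → energy G u v ≡ energy H u v
energy-cong G≋H u v = cong₂ _⊓_ (deg-cong G≋H) (deg-cong G≋H)

module _ (α β : ℤ) {G : Graph n} where

  step-diag : (u : Fin n) → step α β G u u ≡ G u u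
  step-diag u with u ≟ u
  ... | yes _ = refl
  ... | no u≢u = contradiction refl u≢u

  module _ {u v : Fin n} (u≢v : u ≢ v) where

    step-low : + energy G u v <ℤ α → step α β G u v ≡ false
    step-low low with u ≟ v | + energy G u v <? α
    ... | yes u≡v | _ = contradiction u≡v u≢v
    ... | no _ | yes _ = refl
    ... | no _ | no ¬low = contradiction low ¬low

    step-mid : ¬ (+ energy G u v <ℤ α) → + energy G u v <ℤ β → step α β G u v ≡ G u v
    step-mid ¬low mid with u ≟ v | + energy G u v <? α | + energy G u v <? β
    ... | yes u≡v | _ | _ = contradiction u≡v u≢v
    ... | no _ | yes low | _ = contradiction low ¬low
    ... | no _ | no _ | yes _ = refl
    ... | no _ | no _ | no ¬mid = contradiction mid ¬mid

    step-high : α ≤ℤ β → β ≤ℤ + energy G u v → step α β G u v ≡ true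
    step-high α≤β high with u ≟ v | + energy G u v <? α | + energy G u v <? β
    ... | yes u≡v | _ | _ = contradiction u≡v u≢v
    ... | no _ | yes low | _ = contradiction (ℤ.≤-trans α≤β high) (ℤ.<⇒≱ low)
    ... | no _ | no _ | yes mid = contradiction high (ℤ.<⇒≱ mid)
    ... | no _ | no _ | no _ = refl

  step-keeps : ∀ {u v} → ¬ (+ energy G u v <ℤ α) → G u v ≡ true → step α β G u v ≡ true
  step-keeps {u} {v} ¬low uv with u ≟ v | + energy G u v <? α | + energy G u v <? β
  ... | yes _ | _ | _ = uv
  ... | no _ | yes low | _ = contradiction low ¬low
  ... | no _ | no _ | yes _ = uv
  ... | no _ | no _ | no _ = refl

  step-adds-only-high : ∀ {u v} → step α β G u v ≡ true →
                        G u v ≡ true ⊎ (u ≢ v × β ≤ℤ + energy G u v)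
  step-adds-only-high {u} {v} e with u ≟ v | + energy G u v <? α | + energy G u v <? β
  ... | yes _ | _ | _ = inj₁ e
  ... | no _ | yes _ | _ = contradiction e λ ()
  ... | no _ | no _ | yes _ = inj₁ e
  ... | no u≢v | no _ | no ¬mid = inj₂ (u≢v , ℤ.≮⇒≥ ¬mid)

step-cong : ∀ α β {G H : Graph n} → G ≋ H → step α β G ≋ step α β H
step-cong α β G≋H u v = cong₂
  (λ b e → if does (u ≟ v) then b
           else if does (+ e <? α) then false
           else if does (+ e <? β) then b else true)
  (G≋H u v) (energy-cong G≋H u v)

run-follows : ∀ α β (F : ℕ → Graph n) → (∀ t → step α β (F t) ≋ F (suc t)) →
              ∀ t → run α β (F 0) t ≋ F t
run-follows α β F F-step zero u v = refl
run-follows α β F F-step (suc t) u v =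
  trans (step-cong α β (run-follows α β F F-step t) u v) (F-step t u v)

⊓-closed : (P : Pred ℕ ℓ) {a b : ℕ} → P a → P b → P (a ⊓ b)
⊓-closed P {a} {b} Pa Pb with ℕ.⊓-sel a b
... | inj₁ a⊓b≡a = subst P (sym a⊓b≡a) Pa
... | inj₂ a⊓b≡b = subst P (sym a⊓b≡b) Pb

module Convergence {α β : ℤ} (α≤β : α ≤ℤ β)
                   (G₀ : Graph n) (G₀-loopless : ∀ u → G₀ u u ≡ false) where

  G : ℕ → Graph n
  G = run α β G₀

  Low : ℕ → Pred (Fin n) 0ℓ
  Low t u = + deg (G t) u <ℤ α

  Low? : ∀ t → Decidable (Low t)
  Low? t u = + deg (G t) u <? α

  High : ℕ → Pred (Fin n) 0ℓ
  High t u = β ≤ℤ + deg (G t) u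

  High? : ∀ t → Decidable (High t)
  High? t u = β ≤ℤ? + deg (G t) u

  EdgesAvoidLow : ℕ → Set
  EdgesAvoidLow t = ∀ u v → G t u v ≡ true → ¬ Low t u × ¬ Low t v

  private
    below-α : ∀ {d d′} → d ≤ d′ → + d′ <ℤ α → + d <ℤ α
    below-α d≤d′ = ℤ.≤-<-trans (+≤+ d≤d′)

    above-β : ∀ {d d′} → d ≤ d′ → β ≤ℤ + d → β ≤ℤ + d′
    above-β d≤d′ β≤d = ℤ.≤-trans β≤d (+≤+ d≤d′)

  G-loopless : ∀ t u → G t u u ≡ false
  G-loopless zero = G₀-loopless
  G-loopless (suc t) u = trans (step-diag α β {G t} u) (G-loopless t u)

  survivors-not-Low : ∀ t u v → G (suc t) u v ≡ true → ¬ Low t u × ¬ Low t v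
  survivors-not-Low t u v e = by-cases (u ≟ v)
    where
    dropped-if-Low : u ≢ v → ∀ {w} → energy (G t) u v ≤ deg (G t) w → ¬ Low t w
    dropped-if-Low u≢v e≤d low =
      contradiction (trans (sym e) (step-low α β u≢v (below-α e≤d low))) λ ()

    by-cases : Dec (u ≡ v) → ¬ Low t u × ¬ Low t v
    by-cases (yes refl) = contradiction (trans (sym e) (G-loopless (suc t) u)) λ ()
    by-cases (no u≢v) = dropped-if-Low u≢v (ℕ.m⊓n≤m _ _) , dropped-if-Low u≢v (ℕ.m⊓n≤n _ _)

  Low-persists : ∀ t → Low t ⊆ᵤ Low (suc t)
  Low-persists t {u} low = below-α (deg-mono {G = G (suc t)} {H = G t} isolated) low
    where
    isolated : ∀ {v} → G (suc t) u v ≡ true → G t u v ≡ true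
    isolated e = contradiction low (proj₁ (survivors-not-Low t u _ e))

  keeps-edges : ∀ t → EdgesAvoidLow t → ∀ u v → G t u v ≡ true → G (suc t) u v ≡ true
  keeps-edges t avoid u v e =
    step-keeps α β {G t} (⊓-closed (λ d → ¬ (+ d <ℤ α)) (proj₁ (avoid u v e)) (proj₂ (avoid u v e))) e

  deg-grows : ∀ t → EdgesAvoidLow t → ∀ u → deg (G t) u ≤ deg (G (suc t)) u
  deg-grows t avoid u = deg-mono {G = G t} {H = G (suc t)} (keeps-edges t avoid u _)

  EdgesAvoidLow-step : ∀ t → EdgesAvoidLow t → EdgesAvoidLow (suc t)
  EdgesAvoidLow-step t avoid u v e =
      (λ low → proj₁ (survivors-not-Low t u v e) (below-α (deg-grows t avoid u) low))
    , (λ low → proj₂ (survivors-not-Low t u v e) (below-α (deg-grows t avoid v) low))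

  EdgesAvoidLow-start : ∀ t → Low (suc t) ⊆ᵤ Low t → EdgesAvoidLow (suc t)
  EdgesAvoidLow-start t Low-stable u v e =
    proj₁ (survivors-not-Low t u v e) ∘ Low-stable , proj₂ (survivors-not-Low t u v e) ∘ Low-stable

  EdgesAvoidLow-from : ∀ s → EdgesAvoidLow s → ∀ k → EdgesAvoidLow (k + s)
  EdgesAvoidLow-from s avoid zero = avoid
  EdgesAvoidLow-from s avoid (suc k) = EdgesAvoidLow-step (k + s) (EdgesAvoidLow-from s avoid k)

  High-persists : ∀ t → EdgesAvoidLow t → High t ⊆ᵤ High (suc t)
  High-persists t avoid {u} = above-β (deg-grows t avoid u)

  stable-once-High-stable : ∀ t → EdgesAvoidLow t → High (suc t) ⊆ᵤ High t →
                            StableAt α β G₀ (suc t)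
  stable-once-High-stable t avoid High-stable u v =
    Bool-ext (keeps-edges (suc t) (EdgesAvoidLow-step t avoid) u v) added-earlier
    where
    added-earlier : G (suc (suc t)) u v ≡ true → G (suc t) u v ≡ true
    added-earlier e with step-adds-only-high α β {G (suc t)} {u} {v} e
    ... | inj₁ old = old
    ... | inj₂ (u≢v , high) = step-high α β {G t} u≢v α≤β (⊓-closed (λ d → β ≤ℤ + d)
            (High-stable (above-β (ℕ.m⊓n≤m _ _) high)) (High-stable (above-β (ℕ.m⊓n≤n _ _) high)))

  converges : ∃[ t ] t ≤ suc n + suc n × StableAt α β G₀ t
  converges =
    let k₁ , k₁≤n , Low-stable = decidable-chain-stabilises Low? Low-persists
        s = suc k₁
        avoid = EdgesAvoidLow-from s (EdgesAvoidLow-start k₁ Low-stable)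
        k₂ , k₂≤n , High-stable =
          decidable-chain-stabilises (λ k → High? (k + s)) (λ k → High-persists (k + s) (avoid k))
    in suc (k₂ + s) , s≤s (ℕ.+-mono-≤ k₂≤n (s≤s k₁≤n))
     , stable-once-High-stable (k₂ + s) (avoid k₂) High-stable

Consecutive : ℕ → ℕ → Set
Consecutive i j = suc i ≡ j ⊎ suc j ≡ i

consecutive? : ∀ i j → Dec (Consecutive i j)
consecutive? i j = (suc i ℕ.≟ j) ⊎-dec (suc j ℕ.≟ i)

Consecutive-sym : ∀ {i j} → Consecutive i j → Consecutive j i
Consecutive-sym (inj₁ eq) = inj₂ eq
Consecutive-sym (inj₂ eq) = inj₁ eq

Consecutive-irrefl : ∀ {i} → ¬ Consecutive i i
Consecutive-irrefl (inj₁ eq) = ℕ.1+n≢n eq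
Consecutive-irrefl (inj₂ eq) = ℕ.1+n≢n eq

PathEdge : Pred ℕ ℓ → Fin n → Fin n → Set ℓ
PathEdge P u v = Consecutive (toℕ u) (toℕ v) × P (toℕ u) × P (toℕ v)

module _ {n : ℕ} {P : Pred ℕ ℓ} (P? : Decidable P) where

  pathEdge? : ∀ (u v : Fin n) → Dec (PathEdge P u v)
  pathEdge? u v = consecutive? (toℕ u) (toℕ v) ×-dec P? (toℕ u) ×-dec P? (toℕ v)

  pathOn : Graph n
  pathOn u v = does (pathEdge? u v)

  pathOn-edge⇔ : {u v : Fin n} → pathOn u v ≡ true ⇔ PathEdge P u v
  pathOn-edge⇔ {u} {v} = does≡true⇔ (pathEdge? u v)

  pathOn-simple : SimpleGraph pathOn
  pathOn-simple = (λ u v → does-⇔ (mk⇔ swap swap) (pathEdge? u v) (pathEdge? v u))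
                , (λ u → dec-false (pathEdge? u u) (Consecutive-irrefl ∘ proj₁))
    where
    swap : {u v : Fin n} → PathEdge P u v → PathEdge P v u
    swap (c , Pu , Pv) = Consecutive-sym c , Pv , Pu

  pathOn-2≤deg : ∀ {i} (w : Fin n) → toℕ w ≡ suc i → suc (suc i) < n →
                 P i → P (suc i) → P (suc (suc i)) → 2 ≤ deg pathOn w
  pathOn-2≤deg {i = i} w w≡1+i 2+i<n Pi P1+i P2+i =
    2≤deg {G = pathOn} (edge-to a (inj₂ (cong suc a≡i) , subst P (sym a≡i) Pi))
                       (edge-to b (inj₁ (sym b≡2+i) , subst P (sym b≡2+i) P2+i)) a≢b
    where
    i<n : i < n
    i<n = ℕ.<-trans (ℕ.n<1+n i) (ℕ.<-trans (ℕ.n<1+n (suc i)) 2+i<n)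

    a b : Fin n
    a = Fin.fromℕ< i<n
    b = Fin.fromℕ< 2+i<n

    a≡i : toℕ a ≡ i
    a≡i = toℕ-fromℕ< i<n

    b≡2+i : toℕ b ≡ suc (suc i)
    b≡2+i = toℕ-fromℕ< 2+i<n

    a≢b : a ≢ b
    a≢b a≡b = ℕ.<⇒≢ (ℕ.m<n⇒m<1+n (ℕ.n<1+n i)) (trans (sym a≡i) (trans (cong toℕ a≡b) b≡2+i))

    edge-to : ∀ v → Consecutive (suc i) (toℕ v) × P (toℕ v) → pathOn w v ≡ true
    edge-to v (c , Pv) = from pathOn-edge⇔
      (subst (λ k → Consecutive k (toℕ v)) (sym w≡1+i) c , subst P (sym w≡1+i) P1+i , Pv)

  pathOn-deg≤1 : (w : Fin n) → ¬ P (suc (toℕ w)) ⊎ (∀ {i} → suc i ≡ toℕ w → ¬ P i) →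
                 deg pathOn w ≤ 1
  pathOn-deg≤1 w (inj₁ ¬P[1+w]) = deg≤1 {G = pathOn} λ wa wb →
    toℕ-injective (ℕ.suc-injective (trans (left (to pathOn-edge⇔ wa)) (sym (left (to pathOn-edge⇔ wb)))))
    where
    left : ∀ {a} → PathEdge P w a → suc (toℕ a) ≡ toℕ w
    left (inj₁ 1+w≡a , _ , Pa) = contradiction (subst P (sym 1+w≡a) Pa) ¬P[1+w]
    left (inj₂ 1+a≡w , _) = 1+a≡w
  pathOn-deg≤1 w (inj₂ ¬P[w-1]) = deg≤1 {G = pathOn} λ wa wb →
    toℕ-injective (trans (sym (right (to pathOn-edge⇔ wa))) (right (to pathOn-edge⇔ wb)))
    where
    right : ∀ {a} → PathEdge P w a → suc (toℕ w) ≡ toℕ a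
    right (inj₁ 1+w≡a , _) = 1+w≡a
    right (inj₂ 1+a≡w , _ , Pa) = contradiction Pa (¬P[w-1] 1+a≡w)

module Peeling (n : ℕ) where

  α β : ℤ
  α = + 2
  β = + suc n

  -- the vertices still on the path after t steps: the interval [t, n - 1 - t]
  Alive : ℕ → Pred ℕ 0ℓ
  Alive t i = t ≤ i × i + t < n

  Alive? : ∀ t → Decidable (Alive t)
  Alive? t i = (t ℕ.≤? i) ×-dec (i + t ℕ.<? n)

  peel : ℕ → Graph n
  peel t = pathOn (Alive? t)

  Alive-anti : ∀ t → Alive (suc t) ⊆ᵤ Alive t
  Alive-anti t {i} (1+t≤i , i+1+t<n) = ℕ.<⇒≤ 1+t≤i , ℕ.≤-<-trans (ℕ.+-monoʳ-≤ i (ℕ.n≤1+n t)) i+1+t<n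

  2≤deg-peel : ∀ t (w : Fin n) → Alive (suc t) (toℕ w) → 2 ≤ deg (peel t) w
  2≤deg-peel t w = interior (toℕ w) refl
    where
    interior : ∀ k → toℕ w ≡ k → Alive (suc t) k → 2 ≤ deg (peel t) w
    interior (suc i) w≡1+i (s≤s t≤i , 1+i+1+t<n) =
      pathOn-2≤deg (Alive? t) w w≡1+i (ℕ.≤-<-trans (ℕ.m≤m+n (suc (suc i)) t) 2+i+t<n)
        (t≤i , ℕ.≤-<-trans (ℕ.+-mono-≤ (ℕ.n≤1+n i) (ℕ.n≤1+n t)) 1+i+1+t<n)
        (ℕ.m≤n⇒m≤1+n t≤i , ℕ.≤-<-trans (ℕ.+-monoʳ-≤ (suc i) (ℕ.n≤1+n t)) 1+i+1+t<n)
        (ℕ.m≤n⇒m≤1+n (ℕ.m≤n⇒m≤1+n t≤i) , 2+i+t<n)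
      where
      2+i+t<n : suc (suc i) + t < n
      2+i+t<n = subst (_< n) (ℕ.+-suc (suc i) t) 1+i+1+t<n

  deg-peel≤1 : ∀ t (w : Fin n) → ¬ Alive (suc t) (toℕ w) → deg (peel t) w ≤ 1
  deg-peel≤1 t w dead = pathOn-deg≤1 (Alive? t) w dead-neighbour
    where
    dead-neighbour : ¬ Alive t (suc (toℕ w)) ⊎ (∀ {i} → suc i ≡ toℕ w → ¬ Alive t i)
    dead-neighbour with suc t ℕ.≤? toℕ w
    ... | yes 1+t≤w =
      inj₁ λ (_ , 1+w+t<n) → dead (1+t≤w , subst (_< n) (sym (ℕ.+-suc (toℕ w) t)) 1+w+t<n)
    ... | no 1+t≰w = inj₂ λ 1+i≡w (t≤i , _) → 1+t≰w (subst (suc t ≤_) 1+i≡w (s≤s t≤i))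

  2≤deg-peel⇒Alive : ∀ t (w : Fin n) → 2 ≤ deg (peel t) w → Alive (suc t) (toℕ w)
  2≤deg-peel⇒Alive t w 2≤d with Alive? (suc t) (toℕ w)
  ... | yes alive = alive
  ... | no dead = contradiction (deg-peel≤1 t w dead) (ℕ.<⇒≱ 2≤d)

  peel-step : ∀ t → step α β (peel t) ≋ peel (suc t)
  peel-step t u v = by-cases (u ≟ v)
    where
    e = energy (peel t) u v

    -- β exceeds every degree, so the process never adds an edge
    below-β : + e <ℤ β
    below-β = +<+ (s≤s (ℕ.≤-trans (ℕ.m⊓n≤m _ _) (deg≤n {G = peel t})))

    by-energy : u ≢ v → Dec (+ e <ℤ α) → step α β (peel t) u v ≡ peel (suc t) u v
    by-energy u≢v (yes low) = trans (step-low α β {peel t} u≢v low)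
      (sym (dec-false (pathEdge? (Alive? (suc t)) u v) λ (_ , alive-u , alive-v) →
        ℤ.<⇒≱ low (+≤+ (ℕ.⊓-glb (2≤deg-peel t u alive-u) (2≤deg-peel t v alive-v)))))
    by-energy u≢v (no ¬low) = trans (step-mid α β {peel t} u≢v ¬low below-β)
      (does-⇔ (mk⇔ survives ancestors) (pathEdge? (Alive? t) u v) (pathEdge? (Alive? (suc t)) u v))
      where
      2≤e : 2 ≤ e
      2≤e = ℤ.drop‿+≤+ (ℤ.≮⇒≥ ¬low)

      survives : PathEdge (Alive t) u v → PathEdge (Alive (suc t)) u v
      survives (c , _) = c , 2≤deg-peel⇒Alive t u (ℕ.≤-trans 2≤e (ℕ.m⊓n≤m _ _))
                           , 2≤deg-peel⇒Alive t v (ℕ.≤-trans 2≤e (ℕ.m⊓n≤n _ _))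

      ancestors : PathEdge (Alive (suc t)) u v → PathEdge (Alive t) u v
      ancestors (c , alive-u , alive-v) = c , Alive-anti t alive-u , Alive-anti t alive-v

    by-cases : Dec (u ≡ v) → step α β (peel t) u v ≡ peel (suc t) u v
    by-cases (yes refl) = trans (step-diag α β {peel t} u)
      (trans (proj₂ (pathOn-simple (Alive? t)) u) (sym (proj₂ (pathOn-simple (Alive? (suc t))) u)))
    by-cases (no u≢v) = by-energy u≢v (+ e <? α)

  run-peel : ∀ t → run α β (peel 0) t ≋ peel t
  run-peel = run-follows α β peel peel-step

  peel-unstable : ∀ t → suc t + t < n → ¬ StableAt α β (peel 0) t
  peel-unstable t 1+t+t<n stable = contradiction (begin
      true                          ≡⟨ sym edge-now ⟩
      peel t u v                    ≡⟨ sym (run-peel t u v) ⟩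
      run α β (peel 0) t u v        ≡⟨ stable u v ⟩
      run α β (peel 0) (suc t) u v  ≡⟨ run-peel (suc t) u v ⟩
      peel (suc t) u v              ≡⟨ no-edge-next ⟩
      false                         ∎) λ ()
    where
    open ≡-Reasoning

    t<n : t < n
    t<n = ℕ.≤-<-trans (ℕ.m≤n⇒m≤1+n (ℕ.m≤m+n t t)) 1+t+t<n

    1+t<n : suc t < n
    1+t<n = ℕ.≤-<-trans (s≤s (ℕ.m≤m+n t t)) 1+t+t<n

    u v : Fin n
    u = Fin.fromℕ< t<n
    v = Fin.fromℕ< 1+t<n

    edge-now : peel t u v ≡ true
    edge-now = from (pathOn-edge⇔ (Alive? t))
      (subst₂ (λ i j → Consecutive i j × Alive t i × Alive t j)
              (sym (toℕ-fromℕ< t<n)) (sym (toℕ-fromℕ< 1+t<n))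
        (inj₁ refl , (ℕ.≤-refl , ℕ.<-trans (ℕ.n<1+n (t + t)) 1+t+t<n) , (ℕ.n≤1+n t , 1+t+t<n)))

    no-edge-next : peel (suc t) u v ≡ false
    no-edge-next = dec-false (pathEdge? (Alive? (suc t)) u v)
      λ (_ , (1+t≤u , _) , _) → ℕ.<-irrefl refl (subst (suc t ≤_) (toℕ-fromℕ< t<n) 1+t≤u)

  stable⇒n≤1+2t : ∀ t → StableAt α β (peel 0) t → n ≤ suc (t + t)
  stable⇒n≤1+2t t stable = ℕ.≮⇒≥ λ 1+t+t<n → peel-unstable t 1+t+t<n stable

1+n+1+n≤4n : ∀ {n} → 1 ≤ n → suc n + suc n ≤ 4 * n
1+n+1+n≤4n {n} 1≤n =
  subst (suc n + suc n ≤_) (sym (4n≡[n+n]+[n+n] n)) (ℕ.+-mono-≤ 1+n≤n+n 1+n≤n+n)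
  where
  1+n≤n+n : suc n ≤ n + n
  1+n≤n+n = ℕ.+-monoˡ-≤ n 1≤n
  4n≡[n+n]+[n+n] : ∀ n → 4 * n ≡ (n + n) + (n + n)
  4n≡[n+n]+[n+n] = solve-∀

n≤1+2t⇒n≤3t : ∀ {n} t → 2 ≤ n → n ≤ suc (t + t) → 1 * n ≤ 3 * t
n≤1+2t⇒n≤3t zero (s≤s (s≤s _)) (s≤s ())
n≤1+2t⇒n≤3t {n} t@(suc _) _ n≤1+2t = subst₂ _≤_ (sym (ℕ.*-identityˡ n)) (sym (3t≡t+[t+t] t))
  (ℕ.≤-trans n≤1+2t (ℕ.+-monoˡ-≤ (t + t) 1≤t))
  where
  1≤t : 1 ≤ t
  1≤t = s≤s z≤n
  3t≡t+[t+t] : ∀ t → 3 * t ≡ t + (t + t)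
  3t≡t+[t+t] = solve-∀

theorem1 :
    (Σ ℕ λ c → ∀ (n : ℕ) (G₀ : Graph n) → SimpleGraph G₀ → ∀ (α β : ℤ) → α ≤ℤ β →
      Σ ℕ λ t → (t ≤ c * n) × StableAt α β G₀ t)
    ×
    (Σ ℕ λ p → Σ ℕ λ q → (0 < p) × (0 < q) ×
      (∀ (N : ℕ) → Σ ℕ λ n → (N ≤ n) × Σ (Graph n) λ G₀ → SimpleGraph G₀ ×
        Σ ℤ λ α → Σ ℤ λ β → (α ≤ℤ β) ×
          (∀ (t : ℕ) → StableAt α β G₀ t → p * n ≤ q * t)))
theorem1 = (4 , within-4n) , (1 , 3 , s≤s z≤n , s≤s z≤n , peeling-is-slow)
  where
  within-4n : ∀ n (G₀ : Graph n) → SimpleGraph G₀ → ∀ α β → α ≤ℤ β →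
              ∃[ t ] t ≤ 4 * n × StableAt α β G₀ t
  within-4n zero _ _ _ _ _ = 0 , z≤n , λ ()
  within-4n (suc _) G₀ (_ , loopless) _ _ α≤β =
    let t , t≤2n+2 , stable = Convergence.converges α≤β G₀ loopless
    in t , ℕ.≤-trans t≤2n+2 (1+n+1+n≤4n (s≤s z≤n)) , stable

  peeling-is-slow : ∀ N → ∃[ n ] N ≤ n × Σ (Graph n) λ G₀ → SimpleGraph G₀ ×
    Σ ℤ λ α → Σ ℤ λ β → α ≤ℤ β × (∀ t → StableAt α β G₀ t → 1 * n ≤ 3 * t)
  peeling-is-slow N = let n = suc (suc N); open Peeling n in
    n , ℕ.m≤n+m N 2 , peel 0 , pathOn-simple (Alive? 0) , α , β , +≤+ (s≤s (s≤s z≤n)) ,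
    λ t stable → n≤1+2t⇒n≤3t t (s≤s (s≤s z≤n)) (stable⇒n≤1+2t t stable)
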